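{- Let $L \in \{\mathbf{K}, \mathbf{KTB}\}$ and let $\varphi$ be a modal formula whose propositional variables are among $p_1,\ldots,p_n$. If $\widehat{\varphi}$ is $L$-satisfiable, then $\widehat{\varphi}$ is satisfied at some world of some model based on a frame for $L$ in which $p_{n+1}$ is true at every world.
   Context: Modal formulas are built from propositional variables $p_1,p_2,\ldots$, $\bot$, $\rightarrow$ and $\Box$, with Kripke semantics as usual. $\mathbf{K}$-satisfiable means satisfied at some world of some Kripke model (over an arbitrary frame); $\mathbf{KTB}$-satisfiable means satisfied at some world of some model over a frame whose accessibility relation is reflexive and symmetric; a frame for $\mathbf{K}$ is any frame, a frame for $\mathbf{KTB}$ is a reflexive symmetric frame. The translation $\cdot'$ is defined recursively by $p_i' = p_i$ for $i\in\{1,\ldots,n\}$, $\bot' = \bot$, $(\phi\rightarrow\psi)' = \phi'\rightarrow\psi'$, $(\Box\phi)' = \Box(p_{n+1}\rightarrow\phi')$; and $\widehat{\varphi} = p_{n+1}\wedge\varphi'$. -}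

module Defs where

open import Data.Nat using (ℕ; suc; _≤_)
open import Data.Product using (Σ; _×_; _,_)
open import Data.Empty using (⊥)
open import Data.Unit using (⊤)

-- Modal formulas: propositional variables p_i (i : ℕ, we use p_1, p_2, ...),
-- ⊥, →, □.
data Form : Set where
  var  : ℕ → Form
  fls  : Form
  _⇒_  : Form → Form → Form
  □_   : Form → Form

infixr 5 _⇒_
infix 6 □_

¬F_ : Form → Form
¬F φ = φ ⇒ fls

_∧F_ : Form → Form → Form
φ ∧F ψ = ¬F (φ ⇒ ¬F ψ)

VarsAmong : ℕ → Form → Set
VarsAmong n (var i) = (1 ≤ i) × (i ≤ n)
VarsAmong n fls = ⊤
VarsAmong n (φ ⇒ ψ) = VarsAmong n φ × VarsAmong n ψ
VarsAmong n (□ φ) = VarsAmong n φ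

record Frame : Set₁ where
  field
    W : Set
    R : W → W → Set

record Model : Set₁ where
  field
    frame : Frame
  open Frame frame public
  field
    V : ℕ → W → Set

open Model

_,_⊨_ : (M : Model) → W M → Form → Set
M , w ⊨ var i = V M i w
M , w ⊨ fls = ⊥
M , w ⊨ (φ ⇒ ψ) = M , w ⊨ φ → M , w ⊨ ψ
M , w ⊨ (□ φ) = ∀ v → R M w v → M , v ⊨ φ

data Logic : Set where
  K KTB : Logic

FrameFor : Logic → Frame → Set
FrameFor K F = ⊤
FrameFor KTB F = (∀ w → Frame.R F w w) × (∀ w v → Frame.R F w v → Frame.R F v w)

Satisfiable : Logic → Form → Set₁
Satisfiable L φ = Σ Model λ M → FrameFor L (frame M) × Σ (W M) λ w → M , w ⊨ φ

tr : ℕ → Form → Form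
tr n (var i) = var i
tr n fls = fls
tr n (φ ⇒ ψ) = tr n φ ⇒ tr n ψ
tr n (□ φ) = □ (var (suc n) ⇒ tr n φ)

hat : ℕ → Form → Form
hat n φ = var (suc n) ∧F tr n φ

module Submission where

-- Let M satisfy φ̂ = p_{n+1} ∧ φ' at w.  Restrict M to the worlds where
-- p_{n+1} holds and make p_{n+1} true everywhere; the relativised translation
-- φ' only ever looks along edges into p_{n+1}-worlds, so it cannot tell the
-- two models apart.
--
-- Two constructive adjustments make this work over arbitrary (undecidable)
-- valuations and keep reflexivity and symmetry intact:
--   * the new worlds are those where p_{n+1} is not refuted (¬¬ p_{n+1}),
--     since satisfaction of φ̂ only yields ¬¬ p_{n+1} at w;
--   * an old edge w R v is kept when w = v or p_{n+1} holds at both ends.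

open import Defs
open import Data.Nat using (ℕ; suc; _≤_; s≤s)
open import Data.Nat.Properties using (<⇒≢)
open import Data.Product using (Σ; _×_; _,_; proj₁)
open import Data.Sum using (_⊎_; inj₁; inj₂)
open import Data.Empty using (⊥-elim)
open import Data.Unit using (tt)
open import Function.Bundles using (_⇔_; mk⇔; Equivalence)
open import Relation.Binary.PropositionalEquality using (_≡_; _≢_; refl; sym)
open import Relation.Nullary using (¬_)

open Equivalence

below-≢-fresh : ∀ {n i} → i ≤ n → i ≢ suc n
below-≢-fresh i≤n = <⇒≢ (s≤s i≤n)

module Relativise (M : Model) (n : ℕ) where
  open Model M renaming (W to W₀; R to R₀; V to V₀)

  P : W₀ → Set
  P = V₀ (suc n)

  W' : Set
  W' = Σ W₀ λ w → ¬ ¬ P w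

  R' : W' → W' → Set
  R' (w , _) (v , _) = R₀ w v × ((w ≡ v) ⊎ (P w × P v))

  M' : Model
  M' = record
    { frame = record { W = W' ; R = R' }
    ; V     = λ i w → (i ≡ suc n) ⊎ V₀ i (proj₁ w)
    }

  fresh-everywhere : ∀ w → M' , w ⊨ var (suc n)
  fresh-everywhere _ = inj₁ refl

  relativised-frameFor : ∀ L → FrameFor L frame → FrameFor L (Model.frame M')
  relativised-frameFor K   _         = tt
  relativised-frameFor KTB (rf , sy) = reflexive , symmetric
    where
      reflexive : ∀ w → R' w w
      reflexive (w , _) = rf w , inj₁ refl

      symmetric : ∀ w v → R' w v → R' v w
      symmetric _ _ (r , inj₁ w≡v)       = sy _ _ r , inj₁ (sym w≡v)
      symmetric _ _ (r , inj₂ (pw , pv)) = sy _ _ r , inj₂ (pv , pw)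

  P-along-R' : ∀ {w v} → P (proj₁ w) → R' w v → P (proj₁ v)
  P-along-R' pw (_ , inj₁ refl)    = pw
  P-along-R' _  (_ , inj₂ (_ , pv)) = pv

  -- The □ case works because (□ψ)' only
  -- quantifies over p_{n+1}-successors, which are exactly the retained edges.
  truth-lemma : ∀ ψ → VarsAmong n ψ → (w : W') → P (proj₁ w) →
                (M' , w ⊨ tr n ψ) ⇔ (M , proj₁ w ⊨ tr n ψ)
  truth-lemma (var i) (_ , i≤n) _ _ = mk⇔ old-valuation inj₂
    where
      old-valuation : ∀ {x} → (i ≡ suc n) ⊎ x → x
      old-valuation (inj₁ i≡n+1) = ⊥-elim (below-≢-fresh i≤n i≡n+1)
      old-valuation (inj₂ x)     = x
  truth-lemma fls _ _ _ = mk⇔ (λ x → x) (λ x → x)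
  truth-lemma (φ ⇒ ψ) (vφ , vψ) w pw =
    mk⇔ (λ f x → to   IHψ (f (from IHφ x)))
        (λ f x → from IHψ (f (to   IHφ x)))
    where
      IHφ = truth-lemma φ vφ w pw
      IHψ = truth-lemma ψ vψ w pw
  truth-lemma (□ ψ) vψ w pw = mk⇔ forward backward
    where
      forward : M' , w ⊨ tr n (□ ψ) → M , proj₁ w ⊨ tr n (□ ψ)
      forward f v r pv =
        to (truth-lemma ψ vψ v' pv) (f v' (r , inj₂ (pw , pv)) (inj₁ refl))
        where
          v' : W'
          v' = v , λ ¬pv → ¬pv pv

      backward : M , proj₁ w ⊨ tr n (□ ψ) → M' , w ⊨ tr n (□ ψ)
      backward f v r _ =
        from (truth-lemma ψ vψ v pv) (f (proj₁ v) (proj₁ r) pv)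
        where
          pv : P (proj₁ v)
          pv = P-along-R' {w} {v} pw r

  hat-not-refuted : ∀ φ {w} → M , w ⊨ hat n φ → ¬ ¬ P w
  hat-not-refuted φ sat ¬pw = sat (λ pw _ → ¬pw pw)

  hat-transfer : ∀ φ → VarsAmong n φ → ∀ {w} (sat : M , w ⊨ hat n φ) →
                 M' , (w , hat-not-refuted φ sat) ⊨ hat n φ
  hat-transfer φ vφ {w} sat refute =
    sat λ pw φ'w → refute (inj₁ refl) (from (truth-lemma φ vφ w' pw) φ'w)
    where
      w' : W'
      w' = w , hat-not-refuted φ sat

lemma1 : (L : Logic) (n : ℕ) (φ : Form) → VarsAmong n φ →
    Satisfiable L (hat n φ) →
    Σ Model λ M → FrameFor L (Model.frame M) ×
    ((∀ w → M , w ⊨ var (suc n)) × Σ (Model.W M) λ w → M , w ⊨ hat n φ)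
lemma1 L n φ vφ (M , frameForL , w , sat) =
  M' , relativised-frameFor L frameForL , fresh-everywhere ,
  (w , hat-not-refuted φ sat) , hat-transfer φ vφ sat
  where open Relativise M n
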